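{- Let $a\in\{T_0,t_1,t_0,f_1,f_0,F_1\}$. For every formula $\varphi$ and every valuation $v$ over the Nmatrix $\mathcal M_{IvFDE_T}$, we have $v(\theta_a(\varphi))\in D$ if and only if $v(\varphi)=a$.
   Context: Formulas are built from a countable set of propositional variables using binary $\land,\lor,\to$ and unary $\neg,\sim,\square$. Semantics. On $\{0,1\}$ let $\sqcap,\sqcup,\Rightarrow,\sim$ be the Boolean operations. Let $B_T=\{z\in\{0,1\}^4:z_2\le z_1,\ z_1\sqcap z_3=0,\ z_2\sqcap z_4=0,\ z_3\le z_4\}$. Its elements are $T_0=(1,1,0,0)$, $t_0=(1,0,0,0)$, $t_1=(1,0,0,1)$, $f_0=(0,0,0,0)$, $f_1=(0,0,0,1)$ and $F_1=(0,0,1,1)$. The designated set is $D=\{z\in B_T:z_1=1\}$. The Nmatrix $\mathcal M_{IvFDE_T}$ has the following multioperations: - $z\tilde\land w=\{u\in B_T:u_1=z_1\sqcap w_1,\ u_2=z_2\sqcap w_2,\ u_4=z_4\sqcup w_4,\ z_3\sqcup w_3\le u_3\le(z_2\Rightarrow w_3)\sqcap(w_2\Rightarrow z_3)\}$; - $z\tilde\lor w=\{u:u_1=z_1\sqcup w_1,\ u_3=z_3\sqcap w_3,\ u_4=z_4\sqcap w_4,\ z_2\sqcup w_2\le u_2\le(z_3\Rightarrow w_2)\sqcap(w_3\Rightarrow z_2)\}$; - $z\tilde\to w=\{u:u_1=z_1\Rightarrow w_1,\ u_3=z_2\sqcap w_3,\ u_4=z_1\sqcap w_4,\ z_3\sqcup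 w_2\le u_2\le(z_2\Rightarrow w_2)\sqcap(w_3\Rightarrow z_3)\}$; - $\tilde\sim z=\{u:u_1=\sim z_1,\ u_2=z_3,\ u_3=z_2,\ z_2\le u_4\le\sim z_3\}$; - $\tilde\neg z=\{(z_4,z_3,z_2,z_1)\}$; - $\tilde\square z=\{u\in B_T:u_1=z_2\}$. A valuation is a map $v$ from formulas to $B_T$ with $v(\#(\varphi_1,\ldots,\varphi_n))\in\tilde\#(v(\varphi_1),\ldots,v(\varphi_n))$. The formulas $\theta_a$ are defined by: - $\theta_{T_0}(\varphi)=\square\varphi$; - $\theta_{t_1}(\varphi)=\varphi\land\neg\varphi$; - $\theta_{t_0}(\varphi)=\varphi\land\sim\neg\varphi\land\sim\square\varphi$; - $\theta_{f_1}(\varphi)=\sim\varphi\land\neg\varphi\land\sim\square\sim\varphi$; - $\theta_{f_0}(\varphi)=\sim\varphi\land\sim\neg\varphi$; - $\theta_{F_1}(\varphi)=\square\sim\varphi$. -}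

module Defs where

open import Data.Nat using (ℕ)
open import Data.Bool using (Bool; true; false; _∧_; _∨_; not; _≤_)
open import Relation.Binary.PropositionalEquality using (_≡_)
open import Data.Product using (_×_)

_⇒_ : Bool → Bool → Bool
x ⇒ y = not x ∨ y

infixr 5 _⇒_

-- The six elements of B_T = {z ∈ {0,1}^4 : z2 ≤ z1, z1 ⊓ z3 = 0, z2 ⊓ z4 = 0, z3 ≤ z4},
-- presented by enumeration together with their four coordinates.
data BT : Set where
  T₀ t₀ t₁ f₀ f₁ F₁ : BT

c₁ c₂ c₃ c₄ : BT → Bool
c₁ T₀ = true
c₁ t₀ = true
c₁ t₁ = true
c₁ f₀ = false
c₁ f₁ = false
c₁ F₁ = false
c₂ T₀ = true
c₂ t₀ = false
c₂ t₁ = false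
c₂ f₀ = false
c₂ f₁ = false
c₂ F₁ = false
c₃ T₀ = false
c₃ t₀ = false
c₃ t₁ = false
c₃ f₀ = false
c₃ f₁ = false
c₃ F₁ = true
c₄ T₀ = false
c₄ t₀ = false
c₄ t₁ = true
c₄ f₀ = false
c₄ f₁ = true
c₄ F₁ = true

Designated : BT → Set
Designated z = c₁ z ≡ true

-- Multioperations, given as membership relations  u ∈ op(z, w)
AndM : BT → BT → BT → Set
AndM z w u =
  (c₁ u ≡ (c₁ z ∧ c₁ w)) × (c₂ u ≡ (c₂ z ∧ c₂ w)) × (c₄ u ≡ (c₄ z ∨ c₄ w)) ×
  ((c₃ z ∨ c₃ w) ≤ c₃ u) × (c₃ u ≤ ((c₂ z ⇒ c₃ w) ∧ (c₂ w ⇒ c₃ z)))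

OrM : BT → BT → BT → Set
OrM z w u =
  (c₁ u ≡ (c₁ z ∨ c₁ w)) × (c₃ u ≡ (c₃ z ∧ c₃ w)) × (c₄ u ≡ (c₄ z ∧ c₄ w)) ×
  ((c₂ z ∨ c₂ w) ≤ c₂ u) × (c₂ u ≤ ((c₃ z ⇒ c₂ w) ∧ (c₃ w ⇒ c₂ z)))

ImpM : BT → BT → BT → Set
ImpM z w u =
  (c₁ u ≡ (c₁ z ⇒ c₁ w)) × (c₃ u ≡ (c₂ z ∧ c₃ w)) × (c₄ u ≡ (c₁ z ∧ c₄ w)) ×
  ((c₃ z ∨ c₂ w) ≤ c₂ u) × (c₂ u ≤ ((c₂ z ⇒ c₂ w) ∧ (c₃ w ⇒ c₃ z)))

SimM : BT → BT → Set
SimM z u =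
  (c₁ u ≡ not (c₁ z)) × (c₂ u ≡ c₃ z) × (c₃ u ≡ c₂ z) ×
  (c₂ z ≤ c₄ u) × (c₄ u ≤ not (c₃ z))

NegM : BT → BT → Set
NegM z u = (c₁ u ≡ c₄ z) × (c₂ u ≡ c₃ z) × (c₃ u ≡ c₂ z) × (c₄ u ≡ c₁ z)

BoxM : BT → BT → Set
BoxM z u = c₁ u ≡ c₂ z

data Form : Set where
  var       : ℕ → Form
  _∧ᶠ_ _∨ᶠ_ _→ᶠ_ : Form → Form → Form
  ¬ᶠ_ ∼ᶠ_ □ᶠ_    : Form → Form

infixr 6 _∧ᶠ_
infixr 5 _∨ᶠ_
infixr 4 _→ᶠ_
infix 8 ¬ᶠ_ ∼ᶠ_ □ᶠ_

record Valuation : Set where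
  field
    val  : Form → BT
    and  : ∀ φ ψ → AndM (val φ) (val ψ) (val (φ ∧ᶠ ψ))
    or   : ∀ φ ψ → OrM  (val φ) (val ψ) (val (φ ∨ᶠ ψ))
    imp  : ∀ φ ψ → ImpM (val φ) (val ψ) (val (φ →ᶠ ψ))
    sim  : ∀ φ → SimM (val φ) (val (∼ᶠ φ))
    neg  : ∀ φ → NegM (val φ) (val (¬ᶠ φ))
    box  : ∀ φ → BoxM (val φ) (val (□ᶠ φ))

open Valuation public

θ : BT → Form → Form
θ T₀ φ = □ᶠ φ
θ t₁ φ = φ ∧ᶠ ¬ᶠ φ
θ t₀ φ = φ ∧ᶠ (∼ᶠ ¬ᶠ φ ∧ᶠ ∼ᶠ □ᶠ φ)
θ f₁ φ = ∼ᶠ φ ∧ᶠ (¬ᶠ φ ∧ᶠ ∼ᶠ □ᶠ ∼ᶠ φ)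
θ f₀ φ = ∼ᶠ φ ∧ᶠ ∼ᶠ ¬ᶠ φ
θ F₁ φ = □ᶠ ∼ᶠ φ

-- The multioperations are nondeterministic, but the first coordinate of each
-- connective occurring in θ_a is a function of its arguments: ∧ takes the
-- conjunction of first coordinates, ∼ negates the first coordinate, ¬ reads off
-- the fourth and □ the second.  So whether θ_a(φ) is designated is a fixed
-- Boolean expression in the coordinates of v(φ), and among the six values of
-- B_T that expression holds exactly at a.
module Submission where

open import Defs
open import Data.Bool using (Bool; true; false; _∧_; not)
open import Data.Product using (proj₁; proj₂)
open import Function.Bundles using (_⇔_; mk⇔)
open import Relation.Binary.PropositionalEquality using (_≡_; refl; trans)

module _ (v : Valuation) where

  ∧ᶠ-c₁ : ∀ φ ψ → c₁ (val v (φ ∧ᶠ ψ)) ≡ c₁ (val v φ) ∧ c₁ (val v ψ)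
  ∧ᶠ-c₁ φ ψ = proj₁ (and v φ ψ)

  ∼ᶠ-c₁ : ∀ φ → c₁ (val v (∼ᶠ φ)) ≡ not (c₁ (val v φ))
  ∼ᶠ-c₁ φ = proj₁ (sim v φ)

  ∼ᶠ-c₂ : ∀ φ → c₂ (val v (∼ᶠ φ)) ≡ c₃ (val v φ)
  ∼ᶠ-c₂ φ = proj₁ (proj₂ (sim v φ))

  ¬ᶠ-c₁ : ∀ φ → c₁ (val v (¬ᶠ φ)) ≡ c₄ (val v φ)
  ¬ᶠ-c₁ φ = proj₁ (neg v φ)

  □ᶠ-c₁ : ∀ φ → c₁ (val v (□ᶠ φ)) ≡ c₂ (val v φ)
  □ᶠ-c₁ φ = box v φ

isᵇ : BT → BT → Bool
isᵇ T₀ x = c₂ x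
isᵇ t₁ x = c₁ x ∧ c₄ x
isᵇ t₀ x = c₁ x ∧ (not (c₄ x) ∧ not (c₂ x))
isᵇ f₁ x = not (c₁ x) ∧ (c₄ x ∧ not (c₃ x))
isᵇ f₀ x = not (c₁ x) ∧ not (c₄ x)
isᵇ F₁ x = c₃ x

c₁-θ : ∀ a φ v → c₁ (val v (θ a φ)) ≡ isᵇ a (val v φ)
c₁-θ T₀ φ v = □ᶠ-c₁ v φ
c₁-θ t₁ φ v
  rewrite ∧ᶠ-c₁ v φ (¬ᶠ φ) | ¬ᶠ-c₁ v φ = refl
c₁-θ t₀ φ v
  rewrite ∧ᶠ-c₁ v φ (∼ᶠ ¬ᶠ φ ∧ᶠ ∼ᶠ □ᶠ φ) | ∧ᶠ-c₁ v (∼ᶠ ¬ᶠ φ) (∼ᶠ □ᶠ φ)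
        | ∼ᶠ-c₁ v (¬ᶠ φ) | ∼ᶠ-c₁ v (□ᶠ φ) | ¬ᶠ-c₁ v φ | □ᶠ-c₁ v φ = refl
c₁-θ f₁ φ v
  rewrite ∧ᶠ-c₁ v (∼ᶠ φ) (¬ᶠ φ ∧ᶠ ∼ᶠ □ᶠ ∼ᶠ φ) | ∧ᶠ-c₁ v (¬ᶠ φ) (∼ᶠ □ᶠ ∼ᶠ φ)
        | ∼ᶠ-c₁ v φ | ¬ᶠ-c₁ v φ | ∼ᶠ-c₁ v (□ᶠ ∼ᶠ φ) | □ᶠ-c₁ v (∼ᶠ φ)
        | ∼ᶠ-c₂ v φ = refl
c₁-θ f₀ φ v
  rewrite ∧ᶠ-c₁ v (∼ᶠ φ) (∼ᶠ ¬ᶠ φ) | ∼ᶠ-c₁ v φ | ∼ᶠ-c₁ v (¬ᶠ φ) | ¬ᶠ-c₁ v φ = refl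
c₁-θ F₁ φ v = trans (□ᶠ-c₁ v (∼ᶠ φ)) (∼ᶠ-c₂ v φ)

isᵇ-refl : ∀ a → isᵇ a a ≡ true
isᵇ-refl T₀ = refl
isᵇ-refl t₀ = refl
isᵇ-refl t₁ = refl
isᵇ-refl f₀ = refl
isᵇ-refl f₁ = refl
isᵇ-refl F₁ = refl

isᵇ-sound : ∀ a x → isᵇ a x ≡ true → x ≡ a
isᵇ-sound T₀ T₀ _ = refl
isᵇ-sound T₀ t₀ ()
isᵇ-sound T₀ t₁ ()
isᵇ-sound T₀ f₀ ()
isᵇ-sound T₀ f₁ ()
isᵇ-sound T₀ F₁ ()
isᵇ-sound t₀ T₀ ()
isᵇ-sound t₀ t₀ _ = refl
isᵇ-sound t₀ t₁ ()
isᵇ-sound t₀ f₀ ()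
isᵇ-sound t₀ f₁ ()
isᵇ-sound t₀ F₁ ()
isᵇ-sound t₁ T₀ ()
isᵇ-sound t₁ t₀ ()
isᵇ-sound t₁ t₁ _ = refl
isᵇ-sound t₁ f₀ ()
isᵇ-sound t₁ f₁ ()
isᵇ-sound t₁ F₁ ()
isᵇ-sound f₀ T₀ ()
isᵇ-sound f₀ t₀ ()
isᵇ-sound f₀ t₁ ()
isᵇ-sound f₀ f₀ _ = refl
isᵇ-sound f₀ f₁ ()
isᵇ-sound f₀ F₁ ()
isᵇ-sound f₁ T₀ ()
isᵇ-sound f₁ t₀ ()
isᵇ-sound f₁ t₁ ()
isᵇ-sound f₁ f₀ ()
isᵇ-sound f₁ f₁ _ = refl
isᵇ-sound f₁ F₁ ()
isᵇ-sound F₁ T₀ ()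
isᵇ-sound F₁ t₀ ()
isᵇ-sound F₁ t₁ ()
isᵇ-sound F₁ f₀ ()
isᵇ-sound F₁ f₁ ()
isᵇ-sound F₁ F₁ _ = refl

isᵇ⇔≡ : ∀ a x → (isᵇ a x ≡ true) ⇔ (x ≡ a)
isᵇ⇔≡ a x = mk⇔ (isᵇ-sound a x) λ { refl → isᵇ-refl a }

mainTheorem7 : (a : BT) (φ : Form) (v : Valuation) →
    Designated (val v (θ a φ)) ⇔ (val v φ ≡ a)
mainTheorem7 a φ v rewrite c₁-θ a φ v = isᵇ⇔≡ a (val v φ)
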